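{- For each positive integer $n$, the following hold: \begin{align*} [n,n+1]&=n(n+1), \\ [n,n+1,n+2]&=\frac{n(n+1)(n+2)}{(2,n)}, \\ [n,n+1,n+2,n+3]&=\frac{n(n+1)(n+2)(n+3)}{2(3,n)}, \\ [n,n+1,n+2,n+3,n+4]&=\frac{n(n+1)(n+2)(n+3)(n+4)}{2(4,n)(3,n(n+1))}, \\ [n,n+1,\ldots,n+5]&=\frac{n(n+1)(n+2)(n+3)(n+4)(n+5)}{6(5,n)(4,n(n+1))}, \\ [n,n+1,\ldots,n+6]&=\frac{n(n+1)(n+2)(n+3)(n+4)(n+5)(n+6)}{12(3,n)(5,n(n+1))\left(4,(n+2)\left(2,\frac{n(n+1)}{2}\right)\right)}. \end{align*}
   Context: For integers $a_1,\ldots,a_k$, $(a_1,\ldots,a_k)$ denotes their greatest common divisor and $[a_1,\ldots,a_k]$ their least common multiple. -}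

module Defs where

open import Data.Nat using (ℕ; _+_)
open import Data.Nat.LCM using (lcm)
open import Data.List using (List; foldr; upTo; map)

lcmList : List ℕ → ℕ
lcmList = foldr lcm 1

-- [n, n+1, …, n+k-1]  (k consecutive integers starting at n)
lcmRange : ℕ → ℕ → ℕ
lcmRange n k = lcmList (map (n +_) (upTo k))

{-# OPTIONS --safe #-}

-- Write δₖ(n) = n(n+1)⋯(n+k−1) / [n,…,n+k−1]. Since [n,…,n+k] = lcm(n, [n+1,…,n+k])
-- and gcd(a,b)·lcm(a,b) = ab, the correction factors satisfy
--   δₖ₊₁(n) = gcd(n δₖ(n+1), (n+1)⋯(n+k)).
-- As (n+1)⋯(n+k) ≡ k! (mod n), this gcd divides k!·δₖ(n+1); so if δₖ always divides b,
-- δₖ₊₁(n) only depends on n modulo k!·b, and each closed form of the theorem is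
-- confirmed by evaluating both sides on one period of residues.

module Submission where

open import Defs
open import Data.Nat using (ℕ; _+_; _*_; _/_; _<_)
open import Data.Nat.GCD using (gcd)
open import Data.Product using (_×_)
open import Relation.Binary.PropositionalEquality using (_≡_)

open import Function using (id; _∘_)
open import Data.Nat using (zero; suc; _%_; _!; NonZero)
open import Data.Nat.Properties
  using (allUpTo?; _≟_; +-suc; +-identityʳ; *-identityˡ; *-identityʳ; *-zeroʳ; *-assoc; *-comm)
open import Data.Nat.DivMod
  using (m%n%n≡m%n; m%n<n; %-distribˡ-+; %-distribˡ-*; m∣n⇒o%n%m≡o%m; m%[n*o]/o≡m/o%n)
open import Data.Nat.Divisibility
  using (_∣_; divides; ∣-refl; ∣-trans; ∣-antisym; ∣m⇒∣m*n; ∣m+n∣m⇒∣n; *-pres-∣; *-monoʳ-∣;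
         %-presˡ-∣; ∣n∣m%n⇒∣m)
open import Data.Nat.GCD using (gcd[m,n]∣m; gcd[m,n]∣n; gcd-greatest; gcd-assoc; c*gcd[m,n]≡gcd[cm,cn])
open import Data.Nat.LCM using (lcm; gcd*lcm)
open import Data.Nat.Tactic.RingSolver using (solve-∀)
open import Data.List using (_∷_; map; applyUpTo)
open import Data.Product using (∃; _,_)
open import Relation.Nullary.Decidable using (Dec; toWitness)
open import Relation.Binary.PropositionalEquality
  using (refl; sym; trans; cong; cong₂; subst; module ≡-Reasoning)

open ≡-Reasoning

rising : ℕ → ℕ → ℕ
rising n zero    = 1
rising n (suc k) = n * rising (suc n) k

rising-sucʳ : ∀ n k → rising n (suc k) ≡ rising n k * (n + k)
rising-sucʳ n zero    = trans (*-identityʳ n) (sym (trans (*-identityˡ (n + 0)) (+-identityʳ n)))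
rising-sucʳ n (suc k) = begin
  n * rising (suc n) (suc k)            ≡⟨ cong (n *_) (rising-sucʳ (suc n) k) ⟩
  n * (rising (suc n) k * (suc n + k))  ≡⟨ *-assoc n _ _ ⟨
  rising n (suc k) * (suc n + k)        ≡⟨ cong (rising n (suc k) *_) (+-suc n k) ⟨
  rising n (suc k) * (n + suc k)        ∎

rising-extend : ∀ {n k p} → rising n k ≡ p → rising n (suc k) ≡ p * (n + k)
rising-extend {n} {k} eq = trans (rising-sucʳ n k) (cong (_* (n + k)) eq)

rising-suc≡*+! : ∀ n k → ∃ λ q → rising (suc n) k ≡ n * q + k !
rising-suc≡*+! n zero = 0 , cong (_+ 1) (sym (*-zeroʳ n))
rising-suc≡*+! n (suc k) with q , eq ← rising-suc≡*+! n k =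
  q * (suc n + k) + k ! , (begin
    rising (suc n) (suc k)                 ≡⟨ rising-sucʳ (suc n) k ⟩
    rising (suc n) k * (suc n + k)         ≡⟨ cong (_* (suc n + k)) eq ⟩
    (n * q + k !) * (suc n + k)            ≡⟨ expand n q (k !) k ⟩
    n * (q * (suc n + k) + k !) + suc k !  ∎)
  where
  expand : ∀ n q f k → (n * q + f) * (suc n + k) ≡ n * (q * (suc n + k) + f) + (f + k * f)
  expand = solve-∀

map-+-applyUpTo-suc : ∀ n (f : ℕ → ℕ) k →
  map (n +_) (applyUpTo (suc ∘ f) k) ≡ map (suc n +_) (applyUpTo f k)
map-+-applyUpTo-suc n f zero    = refl
map-+-applyUpTo-suc n f (suc k) = cong₂ _∷_ (+-suc n (f 0)) (map-+-applyUpTo-suc n (f ∘ suc) k)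

lcmRange-suc : ∀ n k → lcmRange n (suc k) ≡ lcm n (lcmRange (suc n) k)
lcmRange-suc n k = cong₂ lcm (+-identityʳ n) (cong lcmList (map-+-applyUpTo-suc n id k))

lcm*gcd[m*c,n*c]≡m*[n*c] : ∀ m n c → lcm m n * gcd (m * c) (n * c) ≡ m * (n * c)
lcm*gcd[m*c,n*c]≡m*[n*c] m n c = begin
  lcm m n * gcd (m * c) (n * c)  ≡⟨ cong (lcm m n *_) gcd[m*c,n*c]≡c*gcd[m,n] ⟩
  lcm m n * (c * gcd m n)        ≡⟨ rearrange (lcm m n) c (gcd m n) ⟩
  c * (gcd m n * lcm m n)        ≡⟨ cong (c *_) (gcd*lcm m n) ⟩
  c * (m * n)                    ≡⟨ regroup c m n ⟩
  m * (n * c)                    ∎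
  where
  gcd[m*c,n*c]≡c*gcd[m,n] : gcd (m * c) (n * c) ≡ c * gcd m n
  gcd[m*c,n*c]≡c*gcd[m,n] =
    trans (cong₂ gcd (*-comm m c) (*-comm n c)) (sym (c*gcd[m,n]≡gcd[cm,cn] c m n))
  rearrange : ∀ l c g → l * (c * g) ≡ c * (g * l)
  rearrange = solve-∀
  regroup : ∀ c m n → c * (m * n) ≡ m * (n * c)
  regroup = solve-∀

nextCorrection : ℕ → (ℕ → ℕ) → ℕ → ℕ
nextCorrection k δ n = gcd (n * δ (suc n)) (rising (suc n) k)

lcmRange-suc*nextCorrection : ∀ k δ → (∀ n → lcmRange n k * δ n ≡ rising n k) →
  ∀ n → lcmRange n (suc k) * nextCorrection k δ n ≡ rising n (suc k)
lcmRange-suc*nextCorrection k δ hyp n = begin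
  lcmRange n (suc k) * gcd (n * c) (rising (suc n) k)
    ≡⟨ cong₂ (λ l q → l * gcd (n * c) q) (lcmRange-suc n k) (sym (hyp (suc n))) ⟩
  lcm n l * gcd (n * c) (l * c)                        ≡⟨ lcm*gcd[m*c,n*c]≡m*[n*c] n l c ⟩
  n * (l * c)                                          ≡⟨ cong (n *_) (hyp (suc n)) ⟩
  rising n (suc k)                                     ∎
  where
  c = δ (suc n)
  l = lcmRange (suc n) k

nextCorrection∣k!*δ : ∀ k δ n → nextCorrection k δ n ∣ k ! * δ (suc n)
nextCorrection∣k!*δ k δ n with q , eq ← rising-suc≡*+! n k = ∣m+n∣m⇒∣n g∣n*c*q+k!*c g∣n*c*q
  where
  c = δ (suc n)
  g = nextCorrection k δ n
  g∣n*c*q+k!*c : g ∣ n * c * q + k ! * c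
  g∣n*c*q+k!*c = subst (g ∣_) (trans (cong (_* c) eq) (distribute n q (k !) c))
                       (∣m⇒∣m*n c (gcd[m,n]∣n (n * c) (rising (suc n) k)))
    where
    distribute : ∀ n q f c → (n * q + f) * c ≡ n * c * q + f * c
    distribute = solve-∀
  g∣n*c*q : g ∣ n * c * q
  g∣n*c*q = ∣m⇒∣m*n q (gcd[m,n]∣m (n * c) (rising (suc n) k))

infix 4 _≡_mod_
_≡_mod_ : ℕ → ℕ → (N : ℕ) → .{{NonZero N}} → Set
a ≡ b mod N = a % N ≡ b % N

half-cong : ∀ {a b} → a ≡ b mod 4 → a / 2 ≡ b / 2 mod 2
half-cong {a} {b} a≡b = begin
  a / 2 % 2    ≡⟨ m%[n*o]/o≡m/o%n a 2 2 ⟨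
  a % 4 / 2    ≡⟨ cong (_/ 2) a≡b ⟩
  b % 4 / 2    ≡⟨ m%[n*o]/o≡m/o%n b 2 2 ⟩
  b / 2 % 2    ∎

module Mod (N : ℕ) .{{_ : NonZero N}} where

  %-≡mod : ∀ a → a ≡ a % N mod N
  %-≡mod a = sym (m%n%n≡m%n a N)

  +-cong : ∀ {a b c d} → a ≡ b mod N → c ≡ d mod N → a + c ≡ b + d mod N
  +-cong {a} {b} {c} {d} a≡b c≡d = begin
    (a + c) % N          ≡⟨ %-distribˡ-+ a c N ⟩
    (a % N + c % N) % N  ≡⟨ cong₂ (λ x y → (x + y) % N) a≡b c≡d ⟩
    (b % N + d % N) % N  ≡⟨ %-distribˡ-+ b d N ⟨
    (b + d) % N          ∎

  *-cong : ∀ {a b c d} → a ≡ b mod N → c ≡ d mod N → a * c ≡ b * d mod N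
  *-cong {a} {b} {c} {d} a≡b c≡d = begin
    (a * c) % N          ≡⟨ %-distribˡ-* a c N ⟩
    (a % N * (c % N)) % N ≡⟨ cong₂ (λ x y → (x * y) % N) a≡b c≡d ⟩
    (b % N * (d % N)) % N ≡⟨ %-distribˡ-* b d N ⟨
    (b * d) % N          ∎

  suc-cong : ∀ {a b} → a ≡ b mod N → suc a ≡ suc b mod N
  suc-cong = +-cong {1} {1} refl

  rising-cong : ∀ k {a b} → a ≡ b mod N → rising a k ≡ rising b k mod N
  rising-cong zero    _   = refl
  rising-cong (suc k) a≡b = *-cong a≡b (rising-cong k (suc-cong a≡b))

  mod-∣ : ∀ {d a b} .{{_ : NonZero d}} → d ∣ N → a ≡ b mod N → a ≡ b mod d
  mod-∣ {d} {a} {b} d∣N a≡b = begin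
    a % d      ≡⟨ m∣n⇒o%n%m≡o%m d N a d∣N ⟨
    a % N % d  ≡⟨ cong (_% d) a≡b ⟩
    b % N % d  ≡⟨ m∣n⇒o%n%m≡o%m d N b d∣N ⟩
    b % d      ∎

  ∣-resp-≡mod : ∀ {d a b} → d ∣ N → a ≡ b mod N → d ∣ a → d ∣ b
  ∣-resp-≡mod d∣N a≡b d∣a = ∣n∣m%n⇒∣m d∣N (subst (_ ∣_) a≡b (%-presˡ-∣ d∣a d∣N))

  gcd-cong : ∀ {d a b} → d ∣ N → a ≡ b mod N → gcd d a ≡ gcd d b
  gcd-cong {d} d∣N a≡b = ∣-antisym (gcd∣gcd a≡b) (gcd∣gcd (sym a≡b))
    where
    gcd∣gcd : ∀ {a b} → a ≡ b mod N → gcd d a ∣ gcd d b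
    gcd∣gcd {a} a≡b = gcd-greatest (gcd[m,n]∣m d a)
      (∣-resp-≡mod (∣-trans (gcd[m,n]∣m d a) d∣N) a≡b (gcd[m,n]∣n d a))

  gcd-gcd-cong : ∀ {a a′ b b′} → a ≡ a′ mod N → b ≡ b′ mod N → gcd N (gcd a b) ≡ gcd N (gcd a′ b′)
  gcd-gcd-cong {a} {a′} {b} {b′} a≡a′ b≡b′ = begin
    gcd N (gcd a b)    ≡⟨ gcd-assoc N a b ⟨
    gcd (gcd N a) b    ≡⟨ cong (λ d → gcd d b) (gcd-cong ∣-refl a≡a′) ⟩
    gcd (gcd N a′) b   ≡⟨ gcd-cong (gcd[m,n]∣m N a′) b≡b′ ⟩
    gcd (gcd N a′) b′  ≡⟨ gcd-assoc N a′ b′ ⟩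
    gcd N (gcd a′ b′)  ∎

nextCorrection≡gcd-residue : ∀ k b .{{_ : NonZero (k ! * b)}} {δ : ℕ → ℕ} →
  (∀ n → δ n ∣ b) → (∀ m n → m ≡ n mod k ! * b → δ m ≡ δ n) →
  ∀ n → nextCorrection k δ n ≡ gcd (k ! * b) (nextCorrection k δ (n % (k ! * b)))
nextCorrection≡gcd-residue k b {δ} δ∣b δ-cong n = begin
  g                                ≡⟨ ∣-antisym (gcd-greatest g∣N ∣-refl) (gcd[m,n]∣n N g) ⟩
  gcd N g                          ≡⟨ gcd-gcd-cong (*-cong n≡r (cong (_% N) (δ-cong _ _ sn≡sr)))
                                                   (rising-cong k sn≡sr) ⟩
  gcd N (nextCorrection k δ r)     ∎
  where
  N = k ! * b
  open Mod N
  g = nextCorrection k δ n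
  r = n % N
  n≡r : n ≡ r mod N
  n≡r = %-≡mod n
  sn≡sr : suc n ≡ suc r mod N
  sn≡sr = suc-cong n≡r
  g∣N : g ∣ N
  g∣N = ∣-trans (nextCorrection∣k!*δ k δ n) (*-monoʳ-∣ (k !) (δ∣b (suc n)))

ResiduesAgree : ℕ → ℕ → (ℕ → ℕ) → (ℕ → ℕ) → Set
ResiduesAgree k N δ δ⁺ = ∀ {r} → r < N → gcd N (nextCorrection k δ r) ≡ δ⁺ r

residuesAgree? : ∀ k N δ δ⁺ → Dec (ResiduesAgree k N δ δ⁺)
residuesAgree? k N δ δ⁺ = allUpTo? (λ r → gcd N (nextCorrection k δ r) ≟ δ⁺ r) N

lcmRange-suc-by-residues : ∀ k b .{{_ : NonZero (k ! * b)}} (δ δ⁺ : ℕ → ℕ) →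
  (∀ n → δ n ∣ b) →
  (∀ m n → m ≡ n mod k ! * b → δ m ≡ δ n) →
  (∀ m n → m ≡ n mod k ! * b → δ⁺ m ≡ δ⁺ n) →
  ResiduesAgree k (k ! * b) δ δ⁺ →
  (∀ n → lcmRange n k * δ n ≡ rising n k) →
  ∀ n → lcmRange n (suc k) * δ⁺ n ≡ rising n (suc k)
lcmRange-suc-by-residues k b δ δ⁺ δ∣b δ-cong δ⁺-cong agree hyp n = begin
  lcmRange n (suc k) * δ⁺ n                   ≡⟨ cong (lcmRange n (suc k) *_) δ⁺≡next ⟩
  lcmRange n (suc k) * nextCorrection k δ n   ≡⟨ lcmRange-suc*nextCorrection k δ hyp n ⟩
  rising n (suc k)                            ∎
  where
  N = k ! * b
  δ⁺≡next : δ⁺ n ≡ nextCorrection k δ n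
  δ⁺≡next = begin
    δ⁺ n                                ≡⟨ δ⁺-cong _ _ (Mod.%-≡mod N n) ⟩
    δ⁺ (n % N)                          ≡⟨ agree (m%n<n n N) ⟨
    gcd N (nextCorrection k δ (n % N))  ≡⟨ nextCorrection≡gcd-residue k b δ∣b δ-cong n ⟨
    nextCorrection k δ n                ∎

δ₁ δ₂ δ₃ δ₄ δ₅ δ₆ δ₇ : ℕ → ℕ
δ₁ _ = 1
δ₂ _ = 1
δ₃ n = gcd 2 n
δ₄ n = 2 * gcd 3 n
δ₅ n = 2 * gcd 4 n * gcd 3 (n * (n + 1))
δ₆ n = 6 * gcd 5 n * gcd 4 (n * (n + 1))
δ₇ n = 12 * gcd 3 n * gcd 5 (n * (n + 1)) * gcd 4 ((n + 2) * gcd 2 ((n * (n + 1)) / 2))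

δ₃∣2 : ∀ n → δ₃ n ∣ 2
δ₃∣2 n = gcd[m,n]∣m 2 n

δ₄∣6 : ∀ n → δ₄ n ∣ 6
δ₄∣6 n = *-monoʳ-∣ 2 (gcd[m,n]∣m 3 n)

δ₅∣24 : ∀ n → δ₅ n ∣ 24
δ₅∣24 n = *-pres-∣ (*-monoʳ-∣ 2 (gcd[m,n]∣m 4 n)) (gcd[m,n]∣m 3 (n * (n + 1)))

δ₆∣120 : ∀ n → δ₆ n ∣ 120
δ₆∣120 n = *-pres-∣ (*-monoʳ-∣ 6 (gcd[m,n]∣m 5 n)) (gcd[m,n]∣m 4 (n * (n + 1)))

module _ (N : ℕ) .{{_ : NonZero N}} where
  open Mod N

  pronic-cong : ∀ {m n} → m ≡ n mod N → m * (m + 1) ≡ n * (n + 1) mod N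
  pronic-cong m≡n = *-cong m≡n (+-cong m≡n refl)

  δ₃-cong : 2 ∣ N → ∀ m n → m ≡ n mod N → δ₃ m ≡ δ₃ n
  δ₃-cong 2∣N _ _ = gcd-cong 2∣N

  δ₄-cong : 3 ∣ N → ∀ m n → m ≡ n mod N → δ₄ m ≡ δ₄ n
  δ₄-cong 3∣N _ _ m≡n = cong (2 *_) (gcd-cong 3∣N m≡n)

  δ₅-cong : 4 ∣ N → 3 ∣ N → ∀ m n → m ≡ n mod N → δ₅ m ≡ δ₅ n
  δ₅-cong 4∣N 3∣N _ _ m≡n = cong₂ (λ x y → 2 * x * y) (gcd-cong 4∣N m≡n) (gcd-cong 3∣N (pronic-cong m≡n))

  δ₆-cong : 5 ∣ N → 4 ∣ N → ∀ m n → m ≡ n mod N → δ₆ m ≡ δ₆ n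
  δ₆-cong 5∣N 4∣N _ _ m≡n = cong₂ (λ x y → 6 * x * y) (gcd-cong 5∣N m≡n) (gcd-cong 4∣N (pronic-cong m≡n))

  δ₇-cong : 3 ∣ N → 5 ∣ N → 4 ∣ N → ∀ m n → m ≡ n mod N → δ₇ m ≡ δ₇ n
  δ₇-cong 3∣N 5∣N 4∣N m n m≡n =
    cong₂ _*_ (cong₂ (λ x y → 12 * x * y) (gcd-cong 3∣N m≡n) (gcd-cong 5∣N (pronic-cong m≡n)))
              (gcd-cong 4∣N (*-cong {m + 2} {n + 2} (+-cong {m} {n} {2} m≡n refl) (cong (_% N) half-pronic-parity)))
    where
    half-pronic-parity : gcd 2 (m * (m + 1) / 2) ≡ gcd 2 (n * (n + 1) / 2)
    half-pronic-parity = Mod.gcd-cong 2 {2} {m * (m + 1) / 2} {n * (n + 1) / 2} ∣-refl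
      (half-cong {m * (m + 1)} {n * (n + 1)} (mod-∣ {4} 4∣N (pronic-cong m≡n)))

lcmRange*δ₁ : ∀ n → lcmRange n 1 * δ₁ n ≡ rising n 1
lcmRange*δ₁ = lcmRange-suc-by-residues 0 1 (λ _ → 1) δ₁ (λ _ → ∣-refl)
  (λ _ _ _ → refl) (λ _ _ _ → refl)
  (toWitness {a? = residuesAgree? 0 1 (λ _ → 1) δ₁} _) (λ _ → refl)

lcmRange*δ₂ : ∀ n → lcmRange n 2 * δ₂ n ≡ rising n 2
lcmRange*δ₂ = lcmRange-suc-by-residues 1 1 δ₁ δ₂ (λ _ → ∣-refl)
  (λ _ _ _ → refl) (λ _ _ _ → refl)
  (toWitness {a? = residuesAgree? 1 1 δ₁ δ₂} _) lcmRange*δ₁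

lcmRange*δ₃ : ∀ n → lcmRange n 3 * δ₃ n ≡ rising n 3
lcmRange*δ₃ = lcmRange-suc-by-residues 2 1 δ₂ δ₃ (λ _ → ∣-refl)
  (λ _ _ _ → refl)
  (δ₃-cong 2 (divides 1 refl))
  (toWitness {a? = residuesAgree? 2 2 δ₂ δ₃} _) lcmRange*δ₂

lcmRange*δ₄ : ∀ n → lcmRange n 4 * δ₄ n ≡ rising n 4
lcmRange*δ₄ = lcmRange-suc-by-residues 3 2 δ₃ δ₄ δ₃∣2
  (δ₃-cong 12 (divides 6 refl))
  (δ₄-cong 12 (divides 4 refl))
  (toWitness {a? = residuesAgree? 3 12 δ₃ δ₄} _) lcmRange*δ₃

lcmRange*δ₅ : ∀ n → lcmRange n 5 * δ₅ n ≡ rising n 5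
lcmRange*δ₅ = lcmRange-suc-by-residues 4 6 δ₄ δ₅ δ₄∣6
  (δ₄-cong 144 (divides 48 refl))
  (δ₅-cong 144 (divides 36 refl) (divides 48 refl))
  (toWitness {a? = residuesAgree? 4 144 δ₄ δ₅} _) lcmRange*δ₄

lcmRange*δ₆ : ∀ n → lcmRange n 6 * δ₆ n ≡ rising n 6
lcmRange*δ₆ = lcmRange-suc-by-residues 5 24 δ₅ δ₆ δ₅∣24
  (δ₅-cong 2880 (divides 720 refl) (divides 960 refl))
  (δ₆-cong 2880 (divides 576 refl) (divides 720 refl))
  (toWitness {a? = residuesAgree? 5 2880 δ₅ δ₆} _) lcmRange*δ₅

lcmRange*δ₇ : ∀ n → lcmRange n 7 * δ₇ n ≡ rising n 7
lcmRange*δ₇ = lcmRange-suc-by-residues 6 120 δ₆ δ₇ δ₆∣120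
  (δ₆-cong 86400 (divides 17280 refl) (divides 21600 refl))
  (δ₇-cong 86400 (divides 28800 refl) (divides 17280 refl) (divides 21600 refl))
  (toWitness {a? = residuesAgree? 6 86400 δ₆ δ₇} _) lcmRange*δ₆

-- risingˡ n k = n (n+1) ⋯ (n+k): k+1 factors, bracketed to the left as in the statement.
risingˡ : ℕ → ℕ → ℕ
risingˡ n zero    = n
risingˡ n (suc k) = risingˡ n k * (n + suc k)

rising≡risingˡ : ∀ n k → rising n (suc k) ≡ risingˡ n k
rising≡risingˡ n zero    = *-identityʳ n
rising≡risingˡ n (suc k) = rising-extend (rising≡risingˡ n k)

lemma2p3 : (n : ℕ) → 0 < n →
    (lcmRange n 2 ≡ n * (n + 1))
    × (lcmRange n 3 * gcd 2 n ≡ n * (n + 1) * (n + 2))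
    × (lcmRange n 4 * (2 * gcd 3 n) ≡ n * (n + 1) * (n + 2) * (n + 3))
    × (lcmRange n 5 * (2 * gcd 4 n * gcd 3 (n * (n + 1)))
        ≡ n * (n + 1) * (n + 2) * (n + 3) * (n + 4))
    × (lcmRange n 6 * (6 * gcd 5 n * gcd 4 (n * (n + 1)))
        ≡ n * (n + 1) * (n + 2) * (n + 3) * (n + 4) * (n + 5))
    × (lcmRange n 7 * (12 * gcd 3 n * gcd 5 (n * (n + 1)) * gcd 4 ((n + 2) * gcd 2 ((n * (n + 1)) / 2)))
        ≡ n * (n + 1) * (n + 2) * (n + 3) * (n + 4) * (n + 5) * (n + 6))
lemma2p3 n _ =
  trans (sym (*-identityʳ (lcmRange n 2))) (trans (lcmRange*δ₂ n) (rising≡risingˡ n 1)) ,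
  trans (lcmRange*δ₃ n) (rising≡risingˡ n 2) ,
  trans (lcmRange*δ₄ n) (rising≡risingˡ n 3) ,
  trans (lcmRange*δ₅ n) (rising≡risingˡ n 4) ,
  trans (lcmRange*δ₆ n) (rising≡risingˡ n 5) ,
  trans (lcmRange*δ₇ n) (rising≡risingˡ n 6)
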